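{- Let $G$ be an oriented graph derived from a Burling tree $(T,r,\ell,c)$. Let $u,v$ be two vertices of $G$ with top-ancestors $u'$ and $v'$ respectively. If $uv$ is an arc of $G$, then either (i) $u'=v'$, $u'\neq u$ and $v'\neq v$; or (ii) $u=u'$ and $uv'$ is an arc of $G$.
   Context: Rooted trees: for a rooted tree $(T,r)$ and $v\neq r$, $p(v)$ is the parent of $v$. A branch is a path $v_1v_2\dots v_k$ of $T$ with $v_i$ the parent of $v_{i+1}$ for all $i$ (it starts at $v_1$); a branch may be empty. Ancestors of $v$ are the vertices of the path from $v$ to the root (including $v$). A Burling tree is a 4-tuple $(T,r,\ell,c)$ where $T$ is a rooted tree with root $r$; $\ell$ assigns to every non-leaf vertex $v$ one of its children $\ell(v)$, the last-born of $v$; and $c$ is a function on $V(T)$ such that if $v\neq r$ is not a last-born then $c(v)$ is the vertex set of a (possibly empty) branch of $T$ starting at $\ell(p(v))$, while $c(v)=\varnothing$ if $v$ is the root or a last-born. The oriented graph fully derived from the Burling tree has vertex set $V(T)$ and an arc $uv$ iff $v\in c(u)$. An oriented graph $G$ is derived from the Burling tree if it is an induced subgraph of the fully derived oriented graph. The top-set of $G$ (with respect to the tree) is the set of vertices $v$ of $G$ such that $v$ is the only vertex of $G$ on the path of $T$ from $r$ to $v$. Every vertex $u$ of $G$ has a unique ancestor in the top-set, called the top-ancestor of $u$. -}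

module Defs where

open import Level using (0ℓ)
open import Data.Nat using (ℕ)
open import Data.Fin using (Fin)
open import Data.Maybe using (Maybe; just; nothing)
open import Data.List using (List; []; _∷_)
open import Data.List.Membership.Propositional using (_∈_)
open import Data.Product using (Σ; _×_; ∃)
open import Data.Sum using (_⊎_)
open import Data.Unit using (⊤)
open import Relation.Nullary using (¬_)
open import Relation.Unary using (Pred)
open import Relation.Binary.PropositionalEquality using (_≡_)

data Anc {n : ℕ} (parent : Fin n → Maybe (Fin n)) : Fin n → Fin n → Set where
  here : ∀ {v} → Anc parent v v
  step : ∀ {u v w} → parent v ≡ just w → Anc parent u w → Anc parent u v

Chain : {n : ℕ} → (Fin n → Maybe (Fin n)) → Fin n → List (Fin n) → Set
Chain parent x []       = ⊤
Chain parent x (y ∷ ys) = (parent y ≡ just x) × Chain parent y ys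

IsBranchFrom : {n : ℕ} → (Fin n → Maybe (Fin n)) → Fin n → List (Fin n) → Set
IsBranchFrom parent a []       = ⊤
IsBranchFrom parent a (x ∷ xs) = (a ≡ x) × Chain parent x xs

record BurlingTree (n : ℕ) : Set where
  field
    root        : Fin n
    parent      : Fin n → Maybe (Fin n)
    parent-root : parent root ≡ nothing
    parent-none : ∀ v → parent v ≡ nothing → v ≡ root
    reach-root  : ∀ v → Anc parent root v
    ℓ           : Fin n → Fin n
    ℓ-child     : ∀ v w → parent w ≡ just v → parent (ℓ v) ≡ just v
    c           : Fin n → List (Fin n)

  IsLastBorn : Fin n → Set
  IsLastBorn w = ∃ λ p → (parent w ≡ just p) × (ℓ p ≡ w)

  field
    c-trivial : ∀ v → (v ≡ root ⊎ IsLastBorn v) → c v ≡ []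
    c-branch  : ∀ v p → parent v ≡ just p → ¬ (ℓ p ≡ v) → IsBranchFrom parent (ℓ p) (c v)

  Arc : Fin n → Fin n → Set
  Arc u v = v ∈ c u

  -- G = induced subgraph on vertex set S (arcs of G between vertices of S are Arc).
  -- Top-set of G.
  TopSet : Pred (Fin n) 0ℓ → Fin n → Set
  TopSet S v = S v × (∀ w → Anc parent w v → S w → w ≡ v)

  IsTopAncestor : Pred (Fin n) 0ℓ → Fin n → Fin n → Set
  IsTopAncestor S u u' = TopSet S u' × Anc parent u' u

{-# OPTIONS --safe #-}
module Submission where

-- The arc uv forces u to have a parent p, and c(u) is a downward path
-- starting at a child of p, so v lies strictly below p. If u is in the
-- top-set, every ancestor of v either lies on c(u) or is an ancestor of u;
-- the latter would make v' = u an ancestor of its own parent. Otherwise u'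
-- is an ancestor of p, hence of v, and two top-set ancestors of the same
-- vertex coincide; v' = v would again put v above its own parent.

open import Defs
open import Level using (0ℓ)
open import Data.Nat using (ℕ)
open import Data.Fin using (Fin)
open import Data.Fin.Properties using (_≟_)
open import Data.Maybe using (Maybe; just; nothing)
open import Data.List using ([]; _∷_)
open import Data.List.Relation.Unary.Any using (here; there)
open import Data.List.Membership.Propositional using (_∈_)
open import Data.Product using (_×_; _,_; ∃; proj₁)
open import Data.Sum using (_⊎_; inj₁; inj₂; map₁)
open import Data.Empty using (⊥-elim)
open import Data.Unit using (tt)
open import Relation.Nullary using (¬_; yes; no)
open import Relation.Unary using (Pred)
open import Relation.Binary.PropositionalEquality
  using (_≡_; _≢_; refl; sym; trans; subst; ≢-sym)

module Ancestry {n : ℕ} (parent : Fin n → Maybe (Fin n)) where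

  StrictAnc : Fin n → Fin n → Set
  StrictAnc a v = ∃ λ w → parent v ≡ just w × Anc parent a w

  anc-trans : ∀ {a b v} → Anc parent a b → Anc parent b v → Anc parent a v
  anc-trans p here       = p
  anc-trans p (step e q) = step e (anc-trans p q)

  strict⇒anc : ∀ {a v} → StrictAnc a v → Anc parent a v
  strict⇒anc (_ , e , a) = step e a

  anc-strict-trans : ∀ {a b v} → Anc parent a b → StrictAnc b v → StrictAnc a v
  anc-strict-trans ab (w , e , bw) = w , e , anc-trans ab bw

  anc-split : ∀ {a v p} → parent v ≡ just p → Anc parent a v → a ≡ v ⊎ Anc parent a p
  anc-split e here = inj₁ refl
  anc-split e (step e′ a) with trans (sym e) e′
  ... | refl = inj₂ a

  anc-comparable : ∀ {a b v} → Anc parent a v → Anc parent b v →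
                   Anc parent a b ⊎ Anc parent b a
  anc-comparable here       q           = inj₂ q
  anc-comparable (step e a) here        = inj₁ (step e a)
  anc-comparable (step e a) (step e′ b) with trans (sym e) e′
  ... | refl = anc-comparable a b

  strict-irrefl : ∀ {r x} → parent r ≡ nothing → Anc parent r x → ¬ StrictAnc x x
  strict-irrefl pr here (_ , e , _) with trans (sym pr) e
  ... | ()
  strict-irrefl pr (step e q) (_ , e′ , a) with trans (sym e) e′
  ... | refl = strict-irrefl pr q (rotate a)
    where
    -- a cycle through x and its parent w is also a cycle through w
    rotate : Anc parent _ _ → StrictAnc _ _
    rotate here         = _ , e , here
    rotate (step e₂ a₂) = _ , e₂ , anc-trans (step e here) a₂

  chain-strict : ∀ {x xs v} → Chain parent x xs → v ∈ xs → StrictAnc x v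
  chain-strict (e , _) (here refl) = _ , e , here
  chain-strict (e , ch) (there m) with chain-strict ch m
  ... | w , e′ , a = w , e′ , anc-trans (step e here) a

  chain-anc : ∀ {x xs v y} → Chain parent x xs → v ∈ xs → Anc parent y v →
              y ∈ xs ⊎ Anc parent y x
  chain-anc (e , _) (here refl) a = map₁ (λ { refl → here refl }) (anc-split e a)
  chain-anc (e , ch) (there m) a with chain-anc ch m a
  ... | inj₁ k  = inj₁ (there k)
  ... | inj₂ a′ = map₁ (λ { refl → here refl }) (anc-split e a′)

  branch-chain : ∀ {a p xs} → parent a ≡ just p → IsBranchFrom parent a xs →
                 Chain parent p xs
  branch-chain {xs = []}    e _           = tt
  branch-chain {xs = _ ∷ _} e (refl , ch) = e , ch

module Burling {n : ℕ} (B : BurlingTree n) where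
  open BurlingTree B
  open Ancestry parent public

  no-strict-cycle : ∀ {x} → ¬ StrictAnc x x
  no-strict-cycle = strict-irrefl parent-root (reach-root _)

  arc-source-nonempty : ∀ {u v} → Arc u v → c u ≢ []
  arc-source-nonempty arc eq with subst (_ ∈_) eq arc
  ... | ()

  arc-source-chain : ∀ {u v} → Arc u v → ∃ λ p → parent u ≡ just p × Chain parent p (c u)
  arc-source-chain {u} arc with parent u in pu
  ... | nothing = ⊥-elim (arc-source-nonempty arc (c-trivial u (inj₁ (parent-none u pu))))
  ... | just p with ℓ p ≟ u
  ...   | yes lu  = ⊥-elim (arc-source-nonempty arc (c-trivial u (inj₂ (p , pu , lu))))
  ...   | no ¬lu = p , refl , branch-chain (ℓ-child p u pu) (c-branch u p pu ¬lu)

  top-unique : ∀ {S a b x} → TopSet S a → TopSet S b →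
               Anc parent a x → Anc parent b x → a ≡ b
  top-unique (Sa , topa) (Sb , topb) ax bx with anc-comparable ax bx
  ... | inj₁ ab = topb _ ab Sa
  ... | inj₂ ba = sym (topa _ ba Sb)

  top-arc-closed : ∀ {S u v w} → TopSet S u → S w → Anc parent w v → Arc u v → Arc u w
  top-arc-closed (_ , top-u) Sw wv arc with arc-source-chain arc
  ... | p , pu , ch with chain-anc ch arc wv
  ...   | inj₁ w∈cu = w∈cu
  ...   | inj₂ wp with top-u _ (step pu wp) Sw
  ...     | refl = ⊥-elim (no-strict-cycle (p , pu , wp))

  non-top-arc : ∀ {S u v u′ v′} → IsTopAncestor S u u′ → IsTopAncestor S v v′ →
                u′ ≢ u → Arc u v → u′ ≡ v′ × v′ ≢ v
  non-top-arc {v = v} {u′} {v′} (top-u′ , u′u) (top-v′ , v′v) u′≢u arc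
    with arc-source-chain arc
  ... | p , pu , ch = u′≡v′ , v′≢v
    where
    u′p : Anc parent u′ p
    u′p with anc-split pu u′u
    ... | inj₁ u′≡u = ⊥-elim (u′≢u u′≡u)
    ... | inj₂ u′p  = u′p

    p≺v : StrictAnc p v
    p≺v = chain-strict ch arc

    u′≡v′ : u′ ≡ v′
    u′≡v′ = top-unique top-u′ top-v′ (anc-trans u′p (strict⇒anc p≺v)) v′v

    v′≢v : v′ ≢ v
    v′≢v v′≡v = no-strict-cycle (anc-strict-trans vp p≺v)
      where
      vp : Anc parent v p
      vp = subst (λ x → Anc parent x p) (trans u′≡v′ v′≡v) u′p

lemma4p3 : {n : ℕ} (B : BurlingTree n) (S : Pred (Fin n) 0ℓ)
    (u v u' v' : Fin n) → S u → S v →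
    BurlingTree.IsTopAncestor B S u u' → BurlingTree.IsTopAncestor B S v v' →
    BurlingTree.Arc B u v →
    ((u' ≡ v') × (u' ≢ u) × (v' ≢ v)) ⊎ ((u ≡ u') × BurlingTree.Arc B u v')
lemma4p3 B S u v u' v' _ _ u'-top v'-top@((Sv' , _) , v'v) arc with u ≟ u'
... | yes refl = inj₂ (refl , Burling.top-arc-closed B (proj₁ u'-top) Sv' v'v arc)
... | no u≢u' =
  let u'≡v' , v'≢v = Burling.non-top-arc B u'-top v'-top (≢-sym u≢u') arc
  in  inj₁ (u'≡v' , ≢-sym u≢u' , v'≢v)
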